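{- Let $\mathcal{A}=\{A_1,\ldots,A_L\}$ be a set of strings and let $C$ be an upper bound on the number of distinct characters common to all strings of $\mathcal{A}$, i.e. $|\mathrm{commonChar}(\mathcal{A})|\le C$. Let $M$ be a maximal common subsequence of $\mathcal{A}$ that has a distinguishing subsequence of length at most $D$. Suppose that in the algorithm RandomMCS the character $c$ is selected uniformly at random from the set of common characters at every step. Then the probability $P(M)$ that a single run of RandomMCS (started from the empty string) returns $M$ satisfies $P(M)\ge C^{ -D}$.
   Context: Strings are finite sequences of characters; $|A|$ is the length of $A$; $\oplus$ denotes string concatenation. A subsequence of $A$ is obtained by deleting some characters without changing the order of the rest; a common subsequence of $\mathcal{A}$ is a subsequence of every $A_l$; it is maximal (an MCS) if inserting any single character at any position no longer yields a common subsequence. $\mathrm{commonChar}(\mathcal{B})$ is the set of characters occurring in every string of a finite set of strings $\mathcal{B}$. For a string $A$, $A(0,k]$ is the prefix of the first $k$ characters and $A(k,|A|]$ the suffix after position $k$ (either may be empty). For a subsequence $W$ of $A$ and $0\le k\le|W|$, $\mathrm{Middle}(A,W,k)$ is the substring of $A$ remaining after deleting the shortest prefix of $A$ containing $W(0,k]$ as a subsequence and the shortest suffix of $A$ containing $W(k,|W|]$ as a subsequence. $\mathrm{BreakPoints}(\mathcal{A},W)$ is the set of $k\in\{0,\ldots,|W|\}$ such that $\mathrm{commonChar}(\{\mathrm{Middle}(A_1,W,k),\ldots,\mathrm{Middle}(A_L,W,k)\})\neq\emptyset$. Algorithm RandomMCS: start with $W$ the empty string; repeat: compute $P=\mathrm{BreakPoints}(\mathcal{A},W)$;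 if $P=\emptyset$, return $W$; otherwise choose $k$ at random (uniformly) from $P$, choose a character $c$ at random from $\mathrm{commonChar}(\{\mathrm{Middle}(A_l,W,k):l=1,\ldots,L\})$, and replace $W$ by $W(0,k]\oplus c\oplus W(k,|W|]$. A distinguishing subsequence of an MCS $M$ is a subsequence $S$ of $M$ such that $M$ is the only MCS of $\mathcal{A}$ containing $S$ as a subsequence. -}

module Defs where

open import Data.Nat using (ℕ; zero; suc; _+_; _∸_; _^_; _≤_; NonZero)
open import Data.Nat.Properties using (m^n≢0)
import Data.Nat as ℕ
open import Data.Bool using (Bool; true; false; if_then_else_)
open import Data.Maybe using (Maybe; just; nothing)
import Data.Maybe as Maybe
open import Data.List using (List; []; _∷_; length; take; drop; reverse; _++_; filter; deduplicate; map; concatMap; upTo; all)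
import Data.List.Relation.Unary.Any as Any
open import Data.List.Relation.Unary.All using (All)
open import Data.List.Relation.Binary.Sublist.Propositional using (_⊆_)
open import Data.List.Membership.DecPropositional (ℕ._≟_) using (_∈?_)
open import Data.Integer using (+_)
open import Data.Rational using (ℚ; 0ℚ; 1ℚ; _/_; _*_)
import Data.Rational as ℚ
open import Relation.Nullary using (¬_; does)
open import Relation.Binary.PropositionalEquality using (_≡_)

Str : Set
Str = List ℕ

_⊑_ : Str → Str → Set
W ⊑ A = W ⊆ A

CommonSubseq : List Str → Str → Set
CommonSubseq 𝒜 W = All (W ⊑_) 𝒜

insertAt : ℕ → ℕ → Str → Str
insertAt k c W = take k W ++ (c ∷ drop k W)

IsMCS : List Str → Str → Set
IsMCS 𝒜 M = CommonSubseq 𝒜 M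
  × (∀ (k : ℕ) → k ≤ length M → ∀ (c : ℕ) → ¬ CommonSubseq 𝒜 (insertAt k c M))
  where open import Data.Product using (_×_)

IsDistinguishing : List Str → Str → Str → Set
IsDistinguishing 𝒜 M S = S ⊑ M × (∀ M′ → IsMCS 𝒜 M′ → S ⊑ M′ → M′ ≡ M)
  where open import Data.Product using (_×_)

-- commonChar(ℬ): the set (duplicate-free list) of characters occurring in every
-- string of ℬ.  Only used for nonempty ℬ (for ℬ = [] we return [] by convention).
commonChar : List Str → List ℕ
commonChar [] = []
commonChar (B ∷ ℬ) =
  deduplicate ℕ._≟_ (filter (λ c → Data.List.Relation.Unary.All.all? (c ∈?_) ℬ) B)
  where import Data.List.Relation.Unary.All

-- length of the shortest prefix of A containing W as a subsequence
-- (greedy leftmost matching); nothing if W is not a subsequence of A.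
shortestPrefixLen : Str → Str → Maybe ℕ
shortestPrefixLen [] A = just 0
shortestPrefixLen (w ∷ W) [] = nothing
shortestPrefixLen (w ∷ W) (a ∷ A) =
  if does (w ℕ.≟ a)
    then Maybe.map suc (shortestPrefixLen W A)
    else Maybe.map suc (shortestPrefixLen (w ∷ W) A)

shortestSuffixLen : Str → Str → Maybe ℕ
shortestSuffixLen W A = shortestPrefixLen (reverse W) (reverse A)

-- Middle(A,W,k): A with the shortest prefix containing W(0,k] and the
-- shortest suffix containing W(k,|W|] removed.
-- (Only used when W is a subsequence of A; otherwise returns [].)
Middle : Str → Str → ℕ → Str
Middle A W k with shortestPrefixLen (take k W) A | shortestSuffixLen (drop k W) A
... | just p | just s = drop p (take (length A ∸ s) A)
... | _      | _      = []

middles : List Str → Str → ℕ → List Str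
middles 𝒜 W k = map (λ A → Middle A W k) 𝒜

isNonEmpty : List ℕ → Bool
isNonEmpty [] = false
isNonEmpty (_ ∷ _) = true

BreakPoints : List Str → Str → List ℕ
BreakPoints 𝒜 W = Data.List.filter (λ k → Data.Bool.T? (isNonEmpty (commonChar (middles 𝒜 W k)))) (upTo (suc (length W)))
  where import Data.Bool

-- uniform average of a list of rationals (0 for the empty list, never used)
sumℚ : List ℚ → ℚ
sumℚ [] = 0ℚ
sumℚ (x ∷ xs) = x ℚ.+ sumℚ xs

uniformAvg : List ℚ → ℚ
uniformAvg [] = 0ℚ
uniformAvg (x ∷ xs) = sumℚ (x ∷ xs) * ((+ 1) / suc (length xs))

-- Probability that RandomMCS, run from the current string W with a step budget
-- `fuel`, returns M.  At each step k is uniform in BreakPoints and c is uniform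
-- in commonChar of the middles.  (Budget exhaustion contributes 0; with the
-- budget used below it never happens, since W grows by one character per step
-- and stays a common subsequence.)
runProb : ℕ → List Str → Str → Str → ℚ
runProb fuel 𝒜 M W with BreakPoints 𝒜 W
runProb fuel    𝒜 M W | [] = if does (Data.List.Properties.≡-dec ℕ._≟_ W M) then 1ℚ else 0ℚ
  where import Data.List.Properties
runProb zero    𝒜 M W | (_ ∷ _) = 0ℚ
runProb (suc f) 𝒜 M W | (k ∷ ks) =
  uniformAvg (map (λ k′ →
    uniformAvg (map (λ c → runProb f 𝒜 M (insertAt k′ c W)) (commonChar (middles 𝒜 W k′))))
    (k ∷ ks))

-- P(M): probability that one run of RandomMCS started from the empty string
-- returns M.  Budget: 1 + |A_1| steps (every common subsequence has length ≤ |A_1|).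
budget : List Str → ℕ
budget [] = 0
budget (A ∷ _) = suc (length A)

ProbMCS : List Str → Str → ℚ
ProbMCS 𝒜 M = runProb (budget 𝒜) 𝒜 M []

invPow : (C D : ℕ) → .{{_ : NonZero C}} → ℚ
invPow C D = _/_ (+ 1) (C ^ D) {{m^n≢0 C D}}

-- Let S be a distinguishing subsequence of M, D = |S|, and e(V) the number of embeddings
-- of V into S.  By induction on the number of remaining steps, a run from a common
-- subsequence V returns M with probability at least e(V) · |V|! (D − |V|)! / (D! C^(D − |V|)).  If |V| = D, then V = S, and every run from S ends in an MCS
-- containing S, that is, in M.  Otherwise each embedding of V leaves D − |V| positions of S
-- unused, and these correspond one-to-one to embeddings of single-character insertions into V;
-- each such insertion is a common subsequence, hence a move of RandomMCS, and it is chosen with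
-- probability at least 1 / ((|V| + 1) C).  Summing gives the bound for V; at V = [] it is C^(−D).

module Submission where

open import Defs
open import Data.Bool using (true; false; T; T?; if_then_else_)
open import Data.Empty using (⊥-elim)
open import Data.Maybe using (Maybe; just)
import Data.Maybe as Maybe
open import Data.Nat as ℕ using (ℕ; zero; suc; _+_; _*_; _∸_; _^_; _!; _≤_; _<_; NonZero; z≤n; s≤s)
import Data.Nat.Properties as ℕP
open import Data.Nat.ListAction using (sum)
open import Data.Nat.ListAction.Properties using (sum-++)
open import Data.Nat.Solver using (module +-*-Solver)
import Data.Integer as ℤ
import Data.Integer.Properties as ℤP
open import Data.Rational as ℚ using (ℚ; 0ℚ; 1ℚ; _/_; toℚᵘ)
open import Data.Rational using () renaming (_≤_ to _≤ℚ_)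
import Data.Rational.Properties as ℚP
open import Data.Rational.Unnormalised as ℚᵘ using (mkℚᵘ; *≡*; *≤*)
import Data.Rational.Unnormalised.Properties as ℚᵘP
open import Data.List using (List; []; _∷_; _++_; take; drop; reverse; map; length; [_]; upTo; deduplicate)
import Data.List.Properties as LP
open import Data.List.Membership.Propositional using (_∈_; _∉_)
import Data.List.Membership.Propositional.Properties as MP
open import Data.List.Relation.Unary.Any using (here; there)
open import Data.List.Relation.Unary.All as All using (All; []; _∷_)
import Data.List.Relation.Unary.All.Properties as AllP
open import Data.List.Relation.Unary.Unique.Propositional using (Unique; []; _∷_)
import Data.List.Relation.Unary.Unique.Propositional.Properties as UniqueP
import Data.List.Relation.Unary.Unique.DecPropositional.Properties as UniqueD
open import Data.List.Relation.Binary.Equality.Propositional using (≋⇒≡)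
open import Data.List.Relation.Binary.Sublist.Propositional using (_⊆_; _∷_; _∷ʳ_; ⊆-refl; ⊆-trans; to∈; from∈)
import Data.List.Relation.Binary.Sublist.Propositional.Properties as SP
open import Data.Product using (Σ; _×_; _,_; proj₁; proj₂)
open import Data.Sum using (inj₁; inj₂)
open import Function using (_∘_; case_of_)
open import Relation.Nullary using (Dec; does; yes; no)
open import Relation.Nullary.Decidable using (dec-true; dec-false)
open import Relation.Binary.PropositionalEquality hiding ([_])


sumMap : ∀ {X : Set} → (X → ℕ) → List X → ℕ
sumMap f xs = sum (map f xs)

sumMap-cong : ∀ {X : Set} (xs : List X) {f g : X → ℕ} →
              (∀ {x} → x ∈ xs → f x ≡ g x) → sumMap f xs ≡ sumMap g xs
sumMap-cong []       f≡g = refl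
sumMap-cong (x ∷ xs) f≡g = cong₂ _+_ (f≡g (here refl)) (sumMap-cong xs (f≡g ∘ there))

sumMap-mono : ∀ {X : Set} (xs : List X) {f g : X → ℕ} →
              (∀ {x} → x ∈ xs → f x ≤ g x) → sumMap f xs ≤ sumMap g xs
sumMap-mono []       f≤g = z≤n
sumMap-mono (x ∷ xs) f≤g = ℕP.+-mono-≤ (f≤g (here refl)) (sumMap-mono xs (f≤g ∘ there))

sumMap-+ : ∀ {X : Set} (xs : List X) (f g : X → ℕ) →
           sumMap (λ x → f x + g x) xs ≡ sumMap f xs + sumMap g xs
sumMap-+ []       f g = refl
sumMap-+ (x ∷ xs) f g = trans (cong ((f x + g x) +_) (sumMap-+ xs f g))
  (solve 4 (λ a b c d → (a :+ b) :+ (c :+ d) := (a :+ c) :+ (b :+ d)) refl (f x) (g x) _ _)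
  where open +-*-Solver

sumMap-*ˡ : ∀ {X : Set} (xs : List X) (a : ℕ) (f : X → ℕ) →
            sumMap (λ x → a * f x) xs ≡ a * sumMap f xs
sumMap-*ˡ []       a f = sym (ℕP.*-zeroʳ a)
sumMap-*ˡ (x ∷ xs) a f = trans (cong (a * f x +_) (sumMap-*ˡ xs a f)) (sym (ℕP.*-distribˡ-+ a (f x) _))

sumMap-*ʳ : ∀ {X : Set} (xs : List X) (a : ℕ) (f : X → ℕ) →
            sumMap (λ x → f x * a) xs ≡ sumMap f xs * a
sumMap-*ʳ xs a f = trans (sumMap-cong xs (λ {x} _ → ℕP.*-comm (f x) a))
                         (trans (sumMap-*ˡ xs a f) (ℕP.*-comm a _))

sumMap-zero : ∀ {X : Set} (xs : List X) {f : X → ℕ} → (∀ {x} → x ∈ xs → f x ≡ 0) → sumMap f xs ≡ 0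
sumMap-zero []       f≡0 = refl
sumMap-zero (x ∷ xs) f≡0 = cong₂ _+_ (f≡0 (here refl)) (sumMap-zero xs (f≡0 ∘ there))

sumMap-pos : ∀ {X : Set} (xs : List X) (f : X → ℕ) → 0 < sumMap f xs → Σ X λ x → x ∈ xs × 0 < f x
sumMap-pos (x ∷ xs) f pos with f x in eq
... | suc _ = x , here refl , subst (0 <_) (sym eq) (s≤s z≤n)
... | zero  = let y , y∈ , fy>0 = sumMap-pos xs f pos in y , there y∈ , fy>0

sumMap-++ : ∀ {X : Set} (f : X → ℕ) (xs ys : List X) → sumMap f (xs ++ ys) ≡ sumMap f xs + sumMap f ys
sumMap-++ f xs ys = trans (cong sum (LP.map-++ f xs ys)) (sum-++ (map f xs) (map f ys))

sumMap-const-1 : ∀ {X : Set} (xs : List X) → sumMap (λ _ → 1) xs ≡ length xs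
sumMap-const-1 []       = refl
sumMap-const-1 (x ∷ xs) = cong suc (sumMap-const-1 xs)

sumMap-≤-support : ∀ (xs ys : List ℕ) (f : ℕ → ℕ) → Unique xs →
                   (∀ {x} → x ∈ xs → 0 < f x → x ∈ ys) → sumMap f xs ≤ sumMap f ys
sumMap-≤-support []       ys f _            _ = z≤n
sumMap-≤-support (x ∷ xs) ys f (x∉xs ∷ uxs) support with f x in eq
... | zero = sumMap-≤-support xs ys f uxs (support ∘ there)
... | suc n with MP.∈-∃++ (support (here refl) (subst (0 <_) (sym eq) (s≤s z≤n)))
...   | ys₁ , ys₂ , refl = begin
  suc n + sumMap f xs                    ≤⟨ ℕP.+-monoʳ-≤ (suc n) (sumMap-≤-support xs (ys₁ ++ ys₂) f uxs support′) ⟩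
  suc n + sumMap f (ys₁ ++ ys₂)          ≡⟨ cong (suc n +_) (sumMap-++ f ys₁ ys₂) ⟩
  suc n + (sumMap f ys₁ + sumMap f ys₂)  ≡⟨ solve 3 (λ a b c → a :+ (b :+ c) := b :+ (a :+ c)) refl (suc n) _ _ ⟩
  sumMap f ys₁ + (suc n + sumMap f ys₂)  ≡⟨ cong (λ m → sumMap f ys₁ + (m + sumMap f ys₂)) eq ⟨
  sumMap f ys₁ + sumMap f (x ∷ ys₂)      ≡⟨ sumMap-++ f ys₁ (x ∷ ys₂) ⟨
  sumMap f (ys₁ ++ x ∷ ys₂) ∎
  where
  open ℕP.≤-Reasoning
  open +-*-Solver
  support′ : ∀ {y} → y ∈ xs → 0 < f y → y ∈ ys₁ ++ ys₂
  support′ {y} y∈xs fy>0 with MP.∈-++⁻ ys₁ (support (there y∈xs) fy>0)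
  ... | inj₁ y∈ys₁         = MP.∈-++⁺ˡ y∈ys₁
  ... | inj₂ (here refl)   = ⊥-elim (All.lookup x∉xs y∈xs refl)
  ... | inj₂ (there y∈ys₂) = MP.∈-++⁺ʳ ys₁ y∈ys₂

frac : ℕ → (b : ℕ) → .{{NonZero b}} → ℚ
frac a b = ℤ.+ a / b

toℚᵘ-frac : ∀ a b .{{_ : NonZero b}} → toℚᵘ (frac a b) ℚᵘ.≃ (ℤ.+ a ℚᵘ./ b)
toℚᵘ-frac a (suc b) = ℚP.toℚᵘ-fromℚᵘ (mkℚᵘ (ℤ.+ a) b)

frac-mono : ∀ a b c d .{{_ : NonZero b}} .{{_ : NonZero d}} →
            a * d ≤ c * b → frac a b ℚ.≤ frac c d
frac-mono a b@(suc _) c d@(suc _) ad≤cb = ℚP.toℚᵘ-cancel-≤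
  (ℚᵘP.≤-respˡ-≃ (ℚᵘP.≃-sym (toℚᵘ-frac a b)) (ℚᵘP.≤-respʳ-≃ (ℚᵘP.≃-sym (toℚᵘ-frac c d))
    (*≤* (subst₂ ℤ._≤_ (ℤP.pos-* a d) (ℤP.pos-* c b) (ℤ.+≤+ ad≤cb)))))

frac-+ : ∀ a c b .{{_ : NonZero b}} → frac a b ℚ.+ frac c b ≡ frac (a + c) b
frac-+ a c b@(suc _) = ℚP.toℚᵘ-injective (ℚᵘP.≃-trans (ℚP.toℚᵘ-homo-+ (frac a b) (frac c b))
  (ℚᵘP.≃-trans (ℚᵘP.+-cong (toℚᵘ-frac a b) (toℚᵘ-frac c b))
  (ℚᵘP.≃-trans (*≡* cross) (ℚᵘP.≃-sym (toℚᵘ-frac (a + c) b)))))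
  where
  open +-*-Solver
  cross : (ℤ.+ a ℤ.* ℤ.+ b ℤ.+ ℤ.+ c ℤ.* ℤ.+ b) ℤ.* ℤ.+ b ≡ ℤ.+ (a + c) ℤ.* ℤ.+ (b * b)
  cross = begin
    (ℤ.+ a ℤ.* ℤ.+ b ℤ.+ ℤ.+ c ℤ.* ℤ.+ b) ℤ.* ℤ.+ b
      ≡⟨ cong (λ x → x ℤ.* ℤ.+ b) (cong₂ ℤ._+_ (ℤP.pos-* a b) (ℤP.pos-* c b)) ⟨
    (ℤ.+ (a * b) ℤ.+ ℤ.+ (c * b)) ℤ.* ℤ.+ b  ≡⟨ ℤP.pos-* (a * b + c * b) b ⟨
    ℤ.+ ((a * b + c * b) * b)
      ≡⟨ cong ℤ.+_ (solve 3 (λ a b c → (a :* b :+ c :* b) :* b := (a :+ c) :* (b :* b)) refl a b c) ⟩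
    ℤ.+ ((a + c) * (b * b))              ≡⟨ ℤP.pos-* (a + c) (b * b) ⟩
    ℤ.+ (a + c) ℤ.* ℤ.+ (b * b)        ∎
    where open ≡-Reasoning

frac-* : ∀ a b c d .{{_ : NonZero b}} .{{_ : NonZero d}} →
         frac a b ℚ.* frac c d ≡ frac (a * c) (b * d) {{ℕP.m*n≢0 b d}}
frac-* a b@(suc _) c d@(suc _) = ℚP.toℚᵘ-injective (ℚᵘP.≃-trans (ℚP.toℚᵘ-homo-* (frac a b) (frac c d))
  (ℚᵘP.≃-trans (ℚᵘP.*-cong (toℚᵘ-frac a b) (toℚᵘ-frac c d))
  (ℚᵘP.≃-trans (*≡* (cong (ℤ._* ℤ.+ (b * d)) (sym (ℤP.pos-* a c))))
               (ℚᵘP.≃-sym (toℚᵘ-frac (a * c) (b * d))))))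

0≤frac : ∀ a b .{{_ : NonZero b}} → 0ℚ ℚ.≤ frac a b
0≤frac a b = frac-mono 0 1 a b z≤n

sumℚ-frac : ∀ {X : Set} (xs : List X) (w : X → ℕ) b .{{_ : NonZero b}} →
            sumℚ (map (λ x → frac (w x) b) xs) ≡ frac (sumMap w xs) b
sumℚ-frac []       w b = sym (ℚP.0/n≡0 b)
sumℚ-frac (x ∷ xs) w b = trans (cong (frac (w x) b ℚ.+_) (sumℚ-frac xs w b)) (frac-+ (w x) _ b)

sumℚ-mono : ∀ {X : Set} (xs : List X) (f g : X → ℚ) →
            (∀ {x} → x ∈ xs → f x ℚ.≤ g x) → sumℚ (map f xs) ℚ.≤ sumℚ (map g xs)
sumℚ-mono []       f g f≤g = ℚP.≤-refl
sumℚ-mono (x ∷ xs) f g f≤g = ℚP.+-mono-≤ (f≤g (here refl)) (sumℚ-mono xs f g (f≤g ∘ there))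

frac-sum≤uniformAvg : ∀ {X : Set} (xs : List X) (h : X → ℚ) (w : X → ℕ) (b n : ℕ)
  .{{_ : NonZero b}} .{{_ : NonZero n}} → length xs ≤ n →
  (∀ {x} → x ∈ xs → frac (w x) b ℚ.≤ h x) →
  frac (sumMap w xs) (b * n) {{ℕP.m*n≢0 b n}} ℚ.≤ uniformAvg (map h xs)
frac-sum≤uniformAvg []       h w b n _ _ = frac-mono 0 (b * n) 0 1 {{ℕP.m*n≢0 b n}} z≤n
frac-sum≤uniformAvg (x ∷ xs) h w b n len≤n w≤h = begin
  frac W (b * n) {{ℕP.m*n≢0 b n}}  ≡⟨ cong (λ t → frac t (b * n) {{ℕP.m*n≢0 b n}}) (ℕP.*-identityʳ W) ⟨
  frac (W * 1) (b * n) {{ℕP.m*n≢0 b n}} ≡⟨ frac-* W b 1 n ⟨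
  frac W b ℚ.* frac 1 n
    ≤⟨ ℚP.*-monoˡ-≤-nonNeg (frac W b) {{ℚP.normalize-nonNeg W b}}
         (frac-mono 1 n 1 m (ℕP.≤-trans (ℕP.≤-reflexive (ℕP.*-identityˡ m))
                            (ℕP.≤-trans len≤n (ℕP.≤-reflexive (sym (ℕP.*-identityˡ n)))))) ⟩
  frac W b ℚ.* frac 1 m                             ≡⟨ cong (ℚ._* frac 1 m) (sumℚ-frac (x ∷ xs) w b) ⟨
  sumℚ (map (λ y → frac (w y) b) (x ∷ xs)) ℚ.* frac 1 m
    ≤⟨ ℚP.*-monoʳ-≤-nonNeg (frac 1 m) {{ℚP.normalize-nonNeg 1 m}} (sumℚ-mono (x ∷ xs) _ h w≤h) ⟩
  sumℚ (map h (x ∷ xs)) ℚ.* frac 1 m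
    ≡⟨ cong (λ t → sumℚ (map h (x ∷ xs)) ℚ.* frac 1 (suc t)) (LP.length-map h xs) ⟨
  uniformAvg (map h (x ∷ xs)) ∎
  where
  open ℚP.≤-Reasoning
  W = sumMap w (x ∷ xs)
  m = suc (length xs)

0≤uniformAvg : ∀ {X : Set} (xs : List X) (h : X → ℚ) →
               (∀ {x} → x ∈ xs → 0ℚ ℚ.≤ h x) → 0ℚ ℚ.≤ uniformAvg (map h xs)
0≤uniformAvg xs h 0≤h = ℚP.≤-trans (0≤frac (sumMap (λ _ → 0) xs) (1 * suc (length xs)))
  (frac-sum≤uniformAvg xs h (λ _ → 0) 1 (suc (length xs)) (ℕP.n≤1+n _)
    (λ x∈xs → ℚP.≤-trans (ℚP.≤-reflexive (ℚP.0/n≡0 1)) (0≤h x∈xs)))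

1≤uniformAvg : ∀ {X : Set} {x : X} (xs : List X) (h : X → ℚ) → x ∈ xs →
               (∀ {y} → y ∈ xs → 1ℚ ℚ.≤ h y) → 1ℚ ℚ.≤ uniformAvg (map h xs)
1≤uniformAvg xs@(_ ∷ _) h _ 1≤h = ℚP.≤-trans
  (frac-mono 1 1 (sumMap (λ _ → 1) xs) (1 * length xs)
    (ℕP.≤-reflexive (trans (ℕP.*-identityˡ _) (trans (ℕP.+-identityʳ _)
      (trans (sym (sumMap-const-1 xs)) (sym (ℕP.*-identityʳ _)))))))
  (frac-sum≤uniformAvg xs h (λ _ → 1) 1 (length xs) ℕP.≤-refl 1≤h)

invPow-antitone : ∀ C .{{_ : NonZero C}} {m n} → m ≤ n → invPow C n ℚ.≤ invPow C m
invPow-antitone C {m} {n} m≤n = frac-mono 1 (C ^ n) 1 (C ^ m) {{ℕP.m^n≢0 C n}} {{ℕP.m^n≢0 C m}}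
  (ℕP.*-monoʳ-≤ 1 (ℕP.^-monoʳ-≤ C m≤n))

-- Greedy matching and the middle of a string

shortestPrefixLen-match : ∀ w (W A : Str) →
  shortestPrefixLen (w ∷ W) (w ∷ A) ≡ Maybe.map suc (shortestPrefixLen W A)
shortestPrefixLen-match w W A rewrite dec-true (w ℕ.≟ w) refl = refl

shortestPrefixLen-skip : ∀ {w a} (W A : Str) → w ≢ a →
  shortestPrefixLen (w ∷ W) (a ∷ A) ≡ Maybe.map suc (shortestPrefixLen (w ∷ W) A)
shortestPrefixLen-skip {w} {a} W A w≢a rewrite dec-false (w ℕ.≟ a) w≢a = refl

map-suc-just⁻ : ∀ (m : Maybe ℕ) {p} → Maybe.map suc m ≡ just p → Σ ℕ λ q → m ≡ just q × p ≡ suc q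
map-suc-just⁻ (just q) refl = q , refl , refl

shortestPrefixLen-complete : ∀ (W R A : Str) → W ++ R ⊆ A →
  Σ ℕ λ p → shortestPrefixLen W A ≡ just p × R ⊆ drop p A
shortestPrefixLen-complete []      R A       W++R⊆A = 0 , refl , W++R⊆A
shortestPrefixLen-complete (w ∷ W) R (a ∷ A) W++R⊆A with w ℕ.≟ a
... | yes refl = let p , eq , R⊆ = shortestPrefixLen-complete W R A (SP.∷⁻ W++R⊆A)
                 in suc p , trans (shortestPrefixLen-match w W A) (cong (Maybe.map suc) eq) , R⊆
... | no w≢a   = let p , eq , R⊆ = shortestPrefixLen-complete (w ∷ W) R A (SP.∷ʳ⁻ w≢a W++R⊆A)
                 in suc p , trans (shortestPrefixLen-skip W A w≢a) (cong (Maybe.map suc) eq) , R⊆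

shortestPrefixLen-sound : ∀ (W A : Str) {p} → shortestPrefixLen W A ≡ just p →
                          W ⊆ take p A × p ≤ length A
shortestPrefixLen-sound []      A       refl = SP.[]⊆-universal _ , z≤n
shortestPrefixLen-sound (w ∷ W) (a ∷ A) eq with w ℕ.≟ a
... | yes refl with map-suc-just⁻ (shortestPrefixLen W A) (trans (sym (shortestPrefixLen-match w W A)) eq)
...   | q , eqW , refl = let W⊆ , q≤ = shortestPrefixLen-sound W A eqW in refl ∷ W⊆ , s≤s q≤
shortestPrefixLen-sound (w ∷ W) (a ∷ A) eq | no w≢a
  with map-suc-just⁻ (shortestPrefixLen (w ∷ W) A) (trans (sym (shortestPrefixLen-skip W A w≢a)) eq)
...   | q , eqW , refl = let W⊆ , q≤ = shortestPrefixLen-sound (w ∷ W) A eqW in a ∷ʳ W⊆ , s≤s q≤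

shortestPrefixLen-++ : ∀ (W X Y : Str) {p} → shortestPrefixLen W X ≡ just p →
                       shortestPrefixLen W (X ++ Y) ≡ just p
shortestPrefixLen-++ []      X       Y eq = eq
shortestPrefixLen-++ (w ∷ W) (a ∷ X) Y eq with w ℕ.≟ a
... | yes refl with map-suc-just⁻ (shortestPrefixLen W X) (trans (sym (shortestPrefixLen-match w W X)) eq)
...   | q , eqW , refl = trans (shortestPrefixLen-match w W (X ++ Y))
                               (cong (Maybe.map suc) (shortestPrefixLen-++ W X Y eqW))
shortestPrefixLen-++ (w ∷ W) (a ∷ X) Y eq | no w≢a
  with map-suc-just⁻ (shortestPrefixLen (w ∷ W) X) (trans (sym (shortestPrefixLen-skip W X w≢a)) eq)
...   | q , eqW , refl = trans (shortestPrefixLen-skip W (X ++ Y) w≢a)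
                               (cong (Maybe.map suc) (shortestPrefixLen-++ (w ∷ W) X Y eqW))

drop-length-++ : ∀ (xs ys : Str) → drop (length xs) (xs ++ ys) ≡ ys
drop-length-++ []       ys = refl
drop-length-++ (x ∷ xs) ys = drop-length-++ xs ys

reverse-take : ∀ t (X : Str) → reverse (take t X) ≡ drop (length X ∸ t) (reverse X)
reverse-take t X = begin
  reverse (take t X)
    ≡⟨ drop-length-++ (reverse (drop t X)) _ ⟨
  drop (length (reverse (drop t X))) (reverse (drop t X) ++ reverse (take t X))
    ≡⟨ cong₂ drop (trans (LP.length-reverse (drop t X)) (LP.length-drop t X))
                  (sym (LP.reverse-++ (take t X) (drop t X))) ⟩
  drop (length X ∸ t) (reverse (take t X ++ drop t X))
    ≡⟨ cong (λ Y → drop (length X ∸ t) (reverse Y)) (LP.take++drop≡id t X) ⟩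
  drop (length X ∸ t) (reverse X) ∎
  where open ≡-Reasoning

shortestSuffixLen-sound : ∀ (W A : Str) {s} → shortestSuffixLen W A ≡ just s →
                          W ⊆ drop (length A ∸ s) A × s ≤ length A
shortestSuffixLen-sound W A {s} eq =
  let rW⊆ , s≤ = shortestPrefixLen-sound (reverse W) (reverse A) eq
  in subst₂ _⊆_ (LP.reverse-involutive W)
       (trans (reverse-take s (reverse A))
              (cong₂ drop (cong (_∸ s) (LP.length-reverse A)) (LP.reverse-involutive A)))
       (SP.reverse⁺ rW⊆)
   , subst (s ≤_) (LP.length-reverse A) s≤

shortestSuffixLen-complete : ∀ (R W A : Str) → R ++ W ⊆ A →
  Σ ℕ λ s → shortestSuffixLen W A ≡ just s × R ⊆ take (length A ∸ s) A
shortestSuffixLen-complete R W A R++W⊆A =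
  let s , eq , rR⊆ = shortestPrefixLen-complete (reverse W) (reverse R) (reverse A)
                        (subst (_⊆ reverse A) (LP.reverse-++ R W) (SP.reverse⁺ R++W⊆A))
      s≤ = proj₂ (shortestSuffixLen-sound W A eq)
      drop≡ : drop s (reverse A) ≡ reverse (take (length A ∸ s) A)
      drop≡ = sym (trans (reverse-take (length A ∸ s) A)
                         (cong (λ t → drop t (reverse A)) (ℕP.m∸[m∸n]≡n s≤)))
  in s , eq , SP.reverse⁻ (subst (reverse R ⊆_) drop≡ rR⊆)

shortestSuffixLen-++ : ∀ (W X Y : Str) {s} → shortestSuffixLen W Y ≡ just s →
                       shortestSuffixLen W (X ++ Y) ≡ just s
shortestSuffixLen-++ W X Y eq =
  subst (λ Z → shortestPrefixLen (reverse W) Z ≡ just _) (sym (LP.reverse-++ X Y))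
        (shortestPrefixLen-++ (reverse W) (reverse Y) (reverse X) eq)

Middle-just : ∀ A V k {p s} → shortestPrefixLen (take k V) A ≡ just p →
  shortestSuffixLen (drop k V) A ≡ just s → Middle A V k ≡ drop p (take (length A ∸ s) A)
Middle-just A V k eqp eqs rewrite eqp | eqs = refl

∈-Middle⁺ : ∀ A V k c → insertAt k c V ⊆ A → c ∈ Middle A V k
∈-Middle⁺ A V k c ins⊆A =
  subst (c ∈_) (sym (Middle-just A V k eqp eqs))
        (to∈ c∈)
  where
  prefix = shortestPrefixLen-complete (take k V) (c ∷ drop k V) A ins⊆A
  p = proj₁ prefix
  eqp = proj₁ (proj₂ prefix)
  B = drop p A
  suffix = shortestSuffixLen-complete [ c ] (drop k V) B (proj₂ (proj₂ prefix))
  s = proj₁ suffix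
  eqs′ = proj₁ (proj₂ suffix)
  eqs = subst (λ Z → shortestSuffixLen (drop k V) Z ≡ just s) (LP.take++drop≡id p A)
              (shortestSuffixLen-++ (drop k V) (take p A) B eqs′)
  p≤ = proj₂ (shortestPrefixLen-sound (take k V) A eqp)
  s≤ = proj₂ (shortestSuffixLen-sound (drop k V) B eqs′)
  bounds : p + (length B ∸ s) ≡ length A ∸ s
  bounds = begin
    p + (length B ∸ s)         ≡⟨ ℕP.+-∸-assoc p s≤ ⟨
    (p + length B) ∸ s         ≡⟨ cong (λ b → (p + b) ∸ s) (LP.length-drop p A) ⟩
    (p + (length A ∸ p)) ∸ s   ≡⟨ cong (_∸ s) (ℕP.m+[n∸m]≡n p≤) ⟩
    length A ∸ s ∎
    where open ≡-Reasoning
  c∈ : [ c ] ⊆ drop p (take (length A ∸ s) A)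
  c∈ = subst ([ c ] ⊆_) (trans (LP.take-drop (length B ∸ s) p A) (cong (λ t → drop p (take t A)) bounds))
             (proj₂ (proj₂ suffix))

∈-drop⇒≤length : ∀ {x} p (xs : Str) → x ∈ drop p xs → p ≤ length xs
∈-drop⇒≤length zero    xs       _   = z≤n
∈-drop⇒≤length (suc p) (y ∷ xs) x∈ = s≤s (∈-drop⇒≤length p xs x∈)

take++drop-take++drop : ∀ p t (A : Str) → p ≤ t →
                        take p A ++ (drop p (take t A) ++ drop t A) ≡ A
take++drop-take++drop p t A p≤t = begin
  take p A ++ (drop p (take t A) ++ drop t A)   ≡⟨ LP.++-assoc (take p A) _ _ ⟨
  (take p A ++ drop p (take t A)) ++ drop t A
    ≡⟨ cong (λ X → (X ++ drop p (take t A)) ++ drop t A)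
            (trans (LP.take-take p t A) (cong (λ n → take n A) (ℕP.m≤n⇒m⊓n≡m p≤t))) ⟨
  (take p (take t A) ++ drop p (take t A)) ++ drop t A ≡⟨ cong (_++ drop t A) (LP.take++drop≡id p (take t A)) ⟩
  take t A ++ drop t A                          ≡⟨ LP.take++drop≡id t A ⟩
  A ∎
  where open ≡-Reasoning

∈-Middle⁻ : ∀ A V k c → c ∈ Middle A V k → insertAt k c V ⊆ A
∈-Middle⁻ A V k c c∈
  with shortestPrefixLen (take k V) A in eqp | shortestSuffixLen (drop k V) A in eqs
... | just p | just s = subst (insertAt k c V ⊆_) (take++drop-take++drop p t A p≤t)
                          (SP.++⁺ (proj₁ (shortestPrefixLen-sound (take k V) A eqp))
                          (SP.++⁺ (from∈ c∈) (proj₁ (shortestSuffixLen-sound (drop k V) A eqs))))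
  where
  t = length A ∸ s
  p≤t : p ≤ t
  p≤t = ℕP.≤-trans (∈-drop⇒≤length p (take t A) c∈)
                   (ℕP.≤-trans (ℕP.≤-reflexive (LP.length-take t A)) (ℕP.m⊓n≤m t (length A)))

-- Break points and choices

length-insertAt : ∀ k c (V : Str) → length (insertAt k c V) ≡ suc (length V)
length-insertAt k c V = begin
  length (take k V ++ c ∷ drop k V)         ≡⟨ LP.length-++ (take k V) ⟩
  length (take k V) + suc (length (drop k V)) ≡⟨ ℕP.+-suc _ _ ⟩
  suc (length (take k V) + length (drop k V)) ≡⟨ cong suc (LP.length-++ (take k V)) ⟨
  suc (length (take k V ++ drop k V))         ≡⟨ cong (suc ∘ length) (LP.take++drop≡id k V) ⟩
  suc (length V) ∎
  where open ≡-Reasoning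

⊆-insertAt : ∀ k c (V : Str) → V ⊆ insertAt k c V
⊆-insertAt k c V = subst (_⊆ insertAt k c V) (LP.take++drop≡id k V) (SP.++⁺ ⊆-refl (c ∷ʳ ⊆-refl))

∈-insertAt : ∀ k c (V : Str) → c ∈ insertAt k c V
∈-insertAt k c V = MP.∈-++⁺ʳ (take k V) (here refl)

∈-commonChar⁻ : ∀ {c} B ℬ → c ∈ commonChar (B ∷ ℬ) → c ∈ B × All (c ∈_) ℬ
∈-commonChar⁻ B ℬ c∈ = MP.∈-filter⁻ _ (MP.∈-deduplicate⁻ ℕ._≟_ _ c∈)

∈-commonChar⁺ : ∀ {c} B ℬ → c ∈ B → All (c ∈_) ℬ → c ∈ commonChar (B ∷ ℬ)
∈-commonChar⁺ B ℬ c∈B c∈ℬ = MP.∈-deduplicate⁺ ℕ._≟_ (MP.∈-filter⁺ _ c∈B c∈ℬ)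

commonChar-unique : ∀ ℬ → Unique (commonChar ℬ)
commonChar-unique []      = []
commonChar-unique (B ∷ ℬ) = UniqueD.deduplicate-! ℕ._≟_ _

choices : List Str → Str → ℕ → List ℕ
choices 𝒜 V k = commonChar (middles 𝒜 V k)

∈-choices⁺ : ∀ A 𝒜 V k {c} → CommonSubseq (A ∷ 𝒜) (insertAt k c V) → c ∈ choices (A ∷ 𝒜) V k
∈-choices⁺ A 𝒜 V k {c} (ins⊆A ∷ ins⊆𝒜) =
  ∈-commonChar⁺ _ _ (∈-Middle⁺ A V k c ins⊆A) (AllP.map⁺ (All.map (∈-Middle⁺ _ V k c) ins⊆𝒜))

∈-choices⁻ : ∀ A 𝒜 V k {c} → c ∈ choices (A ∷ 𝒜) V k → CommonSubseq (A ∷ 𝒜) (insertAt k c V)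
∈-choices⁻ A 𝒜 V k {c} c∈ with ∈-commonChar⁻ _ _ c∈
... | c∈A , c∈𝒜 = ∈-Middle⁻ A V k c c∈A ∷ All.map (∈-Middle⁻ _ V k c) (AllP.map⁻ c∈𝒜)

choices⊆commonChar : ∀ A 𝒜 V k {c} → c ∈ choices (A ∷ 𝒜) V k → c ∈ commonChar (A ∷ 𝒜)
choices⊆commonChar A 𝒜 V k {c} c∈ with ∈-choices⁻ A 𝒜 V k c∈
... | ins⊆A ∷ ins⊆𝒜 = ∈-commonChar⁺ A 𝒜 (occurs ins⊆A) (All.map occurs ins⊆𝒜)
  where
  occurs : ∀ {B} → insertAt k c V ⊆ B → c ∈ B
  occurs ins⊆B = SP.Any-resp-⊆ ins⊆B (∈-insertAt k c V)

length-choices : ∀ A 𝒜 V k → length (choices (A ∷ 𝒜) V k) ≤ length (commonChar (A ∷ 𝒜))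
length-choices A 𝒜 V k = begin
  length cs                             ≡⟨ sumMap-const-1 cs ⟨
  sumMap (λ _ → 1) cs                   ≤⟨ sumMap-≤-support cs (commonChar (A ∷ 𝒜)) (λ _ → 1)
                                             (commonChar-unique (middles (A ∷ 𝒜) V k))
                                             (λ c∈ _ → choices⊆commonChar A 𝒜 V k c∈) ⟩
  sumMap (λ _ → 1) (commonChar (A ∷ 𝒜)) ≡⟨ sumMap-const-1 (commonChar (A ∷ 𝒜)) ⟩
  length (commonChar (A ∷ 𝒜)) ∎
  where
  open ℕP.≤-Reasoning
  cs = choices (A ∷ 𝒜) V k

isBreakPoint? : ∀ (𝒜 : List Str) W k → Dec (T (isNonEmpty (choices 𝒜 W k)))
isBreakPoint? 𝒜 W k = T? (isNonEmpty (choices 𝒜 W k))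

∈-BreakPoints⁻ : ∀ 𝒜 W {k} → k ∈ BreakPoints 𝒜 W →
                 k ≤ length W × Σ ℕ (_∈ choices 𝒜 W k)
∈-BreakPoints⁻ 𝒜 W {k} k∈ with MP.∈-filter⁻ (isBreakPoint? 𝒜 W) k∈
... | k∈upTo , nonEmpty with choices 𝒜 W k
...   | c ∷ _ = ℕP.≤-pred (MP.∈-upTo⁻ k∈upTo) , c , here refl

∈-BreakPoints⁺ : ∀ 𝒜 W {k c} → k ≤ length W → c ∈ choices 𝒜 W k →
                 k ∈ BreakPoints 𝒜 W
∈-BreakPoints⁺ 𝒜 W {k} k≤ c∈ = MP.∈-filter⁺ (isBreakPoint? 𝒜 W) (MP.∈-upTo⁺ (s≤s k≤)) (nonEmpty c∈)
  where
  nonEmpty : ∀ {c} {cs : List ℕ} → c ∈ cs → T (isNonEmpty cs)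
  nonEmpty (here _)  = _
  nonEmpty (there _) = _

length-BreakPoints : ∀ 𝒜 W → length (BreakPoints 𝒜 W) ≤ suc (length W)
length-BreakPoints 𝒜 W = ℕP.≤-trans (LP.length-filter (isBreakPoint? 𝒜 W) _)
                                    (ℕP.≤-reflexive (LP.length-upTo _))

breakPoint⇒shorter : ∀ A 𝒜 V {k} → k ∈ BreakPoints (A ∷ 𝒜) V → length V < length A
breakPoint⇒shorter A 𝒜 V {k} k∈ with ∈-BreakPoints⁻ (A ∷ 𝒜) V k∈
... | _ , c , c∈ = subst (_≤ length A) (length-insertAt k c V)
                         (SP.length-mono-≤ (All.head (∈-choices⁻ A 𝒜 V k c∈)))

BreakPoints≡[]⇒IsMCS : ∀ A 𝒜 V → CommonSubseq (A ∷ 𝒜) V → BreakPoints (A ∷ 𝒜) V ≡ [] →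
                       IsMCS (A ∷ 𝒜) V
BreakPoints≡[]⇒IsMCS A 𝒜 V common noBreakPoints = common , λ k k≤ c ins-common →
  case subst (k ∈_) noBreakPoints (∈-BreakPoints⁺ (A ∷ 𝒜) V k≤ (∈-choices⁺ A 𝒜 V k ins-common))
  of λ ()

-- Counting embeddings

δ : ℕ → ℕ → ℕ
δ w s = if does (w ℕ.≟ s) then 1 else 0

δ-refl : ∀ s → δ s s ≡ 1
δ-refl s rewrite dec-true (s ℕ.≟ s) refl = refl

δ-≢ : ∀ w s → w ≢ s → δ w s ≡ 0
δ-≢ w s w≢s rewrite dec-false (w ℕ.≟ s) w≢s = refl

sumMap-δ-∉ : ∀ {s} (U : List ℕ) → s ∉ U → sumMap (λ c → δ c s) U ≡ 0
sumMap-δ-∉ {s} U s∉U = sumMap-zero U (λ {c} c∈U → δ-≢ c s (λ { refl → s∉U c∈U }))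

sumMap-δ-∈ : ∀ {s} (U : List ℕ) → Unique U → s ∈ U → sumMap (λ c → δ c s) U ≡ 1
sumMap-δ-∈ {s} (u ∷ U) (u∉U ∷ _) (here refl) =
  cong₂ _+_ (δ-refl s) (sumMap-δ-∉ U (λ s∈U → All.lookup u∉U s∈U refl))
sumMap-δ-∈ {s} (u ∷ U) (u∉U ∷ uU) (there s∈U) =
  cong₂ _+_ (δ-≢ u s λ { refl → All.lookup u∉U s∈U refl }) (sumMap-δ-∈ U uU s∈U)

embeddings : Str → Str → ℕ
embeddings []      _       = 1
embeddings (_ ∷ _) []      = 0
embeddings (w ∷ W) (s ∷ S) = embeddings (w ∷ W) S + δ w s * embeddings W S

embeddings-pos⇒⊆ : ∀ V S → 0 < embeddings V S → V ⊆ S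
embeddings-pos⇒⊆ []      S       _   = SP.[]⊆-universal S
embeddings-pos⇒⊆ (w ∷ W) (s ∷ S) pos with embeddings (w ∷ W) S in eq
... | suc _ = s ∷ʳ embeddings-pos⇒⊆ (w ∷ W) S (subst (0 <_) (sym eq) (s≤s z≤n))
... | zero with w ℕ.≟ s
...   | yes refl = refl ∷ embeddings-pos⇒⊆ W S
                     (subst (0 <_) (trans (cong (_* embeddings W S) (δ-refl s)) (ℕP.*-identityˡ _)) pos)
...   | no w≢s   = ⊥-elim (ℕP.<-irrefl refl
                     (subst (0 <_) (cong (_* embeddings W S) (δ-≢ w s w≢s)) pos))

embeddings-longer : ∀ V S → length S < length V → embeddings V S ≡ 0
embeddings-longer (w ∷ W) []      _         = refl
embeddings-longer (w ∷ W) (s ∷ S) (s≤s |S|<|W|) =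
  trans (cong₂ (λ m n → m + δ w s * n) (embeddings-longer (w ∷ W) S (ℕP.m<n⇒m<1+n |S|<|W|))
                                       (embeddings-longer W S |S|<|W|))
        (ℕP.*-zeroʳ (δ w s))

embeddings-self : ∀ S → embeddings S S ≡ 1
embeddings-self []      = refl
embeddings-self (s ∷ S) rewrite embeddings-longer (s ∷ S) S (ℕP.n<1+n (length S))
                              | δ-refl s | embeddings-self S = refl

embeddings-insertAt-[] : ∀ k c V → embeddings (insertAt k c V) [] ≡ 0
embeddings-insertAt-[] k c V with take k V
... | []    = refl
... | _ ∷ _ = refl

module _ (U : List ℕ) where

  insertionsAt : ℕ → Str → Str → ℕ
  insertionsAt k V S = sumMap (λ c → embeddings (insertAt k c V) S) U

  insertions : Str → Str → ℕ
  insertions V S = sumMap (λ k → insertionsAt k V S) (upTo (suc (length V)))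

  tailInsertions : ℕ → Str → Str → ℕ
  tailInsertions w W S = sumMap (λ k → insertionsAt (suc k) (w ∷ W) S) (upTo (suc (length W)))

  insertions-∷ : ∀ w W S → insertions (w ∷ W) S ≡ insertionsAt 0 (w ∷ W) S + tailInsertions w W S
  insertions-∷ w W S = cong (λ ks → insertionsAt 0 (w ∷ W) S + sum ks)
    (trans (LP.map-applyUpTo suc g (suc (length W))) (sym (LP.map-upTo (g ∘ suc) (suc (length W)))))
    where g = λ k → insertionsAt k (w ∷ W) S

  insertions-[] : ∀ V → insertions V [] ≡ 0
  insertions-[] V = sumMap-zero (upTo (suc (length V)))
    (λ {k} _ → sumMap-zero U (λ {c} _ → embeddings-insertAt-[] k c V))

  insertionsAt-zero-∷ : Unique U → ∀ V s S → s ∈ U → insertionsAt 0 V (s ∷ S) ≡ insertionsAt 0 V S + embeddings V S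
  insertionsAt-zero-∷ U-unique V s S s∈U = begin
    sumMap (λ c → embeddings (c ∷ V) S + δ c s * embeddings V S) U
      ≡⟨ sumMap-+ U (λ c → embeddings (c ∷ V) S) (λ c → δ c s * embeddings V S) ⟩
    insertionsAt 0 V S + sumMap (λ c → δ c s * embeddings V S) U
      ≡⟨ cong (insertionsAt 0 V S +_) (sumMap-*ʳ U (embeddings V S) (λ c → δ c s)) ⟩
    insertionsAt 0 V S + sumMap (λ c → δ c s) U * embeddings V S
      ≡⟨ cong (λ n → insertionsAt 0 V S + n * embeddings V S) (sumMap-δ-∈ U U-unique s∈U) ⟩
    insertionsAt 0 V S + 1 * embeddings V S
      ≡⟨ cong (insertionsAt 0 V S +_) (ℕP.*-identityˡ _) ⟩
    insertionsAt 0 V S + embeddings V S ∎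
    where open ≡-Reasoning

  tailInsertions-∷ : ∀ w W s S →
    tailInsertions w W (s ∷ S) ≡ tailInsertions w W S + δ w s * insertions W S
  tailInsertions-∷ w W s S = begin
    sumMap (λ k → sumMap (λ c → e₁ k c + δ w s * e₂ k c) U) ks
      ≡⟨ sumMap-cong ks (λ {k} _ → trans (sumMap-+ U (e₁ k) (λ c → δ w s * e₂ k c))
                                         (cong (sumMap (e₁ k) U +_) (sumMap-*ˡ U (δ w s) (e₂ k)))) ⟩
    sumMap (λ k → sumMap (e₁ k) U + δ w s * insertionsAt k W S) ks
      ≡⟨ sumMap-+ ks (λ k → sumMap (e₁ k) U) (λ k → δ w s * insertionsAt k W S) ⟩
    tailInsertions w W S + sumMap (λ k → δ w s * insertionsAt k W S) ks
      ≡⟨ cong (tailInsertions w W S +_) (sumMap-*ˡ ks (δ w s) (λ k → insertionsAt k W S)) ⟩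
    tailInsertions w W S + δ w s * insertions W S ∎
    where
    open ≡-Reasoning
    ks = upTo (suc (length W))
    e₁ e₂ : ℕ → ℕ → ℕ
    e₁ k c = embeddings (w ∷ insertAt k c W) S
    e₂ k c = embeddings (insertAt k c W) S

  -- An embedding of V into S together with one of the |S| − |V| positions of S it leaves
  -- unused is the same as an insertion (k, c) with an embedding of insertAt k c V.  The term
  -- |V| · e(V) sits on the left to avoid truncated subtraction.
  insertions-count : Unique U → ∀ S V → (∀ {s} → s ∈ S → s ∈ U) →
                     insertions V S + length V * embeddings V S ≡ length S * embeddings V S
  insertions-count U-unique []      []      _ rewrite insertions-[] [] = refl
  insertions-count U-unique []      (w ∷ W) _ rewrite insertions-[] (w ∷ W) = ℕP.*-zeroʳ (suc (length W))
  insertions-count U-unique (s ∷ S) []      S⊆U = begin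
    (insertionsAt 0 [] (s ∷ S) + 0) + 0
      ≡⟨ cong (λ n → (n + 0) + 0) (insertionsAt-zero-∷ U-unique [] s S (S⊆U (here refl))) ⟩
    (insertionsAt 0 [] S + 1 + 0) + 0
      ≡⟨ solve 1 (λ x → (x :+ con 1 :+ con 0) :+ con 0 := con 1 :+ ((x :+ con 0) :+ con 0)) refl _ ⟩
    1 + ((insertionsAt 0 [] S + 0) + 0)
      ≡⟨ cong suc (insertions-count U-unique S [] (S⊆U ∘ there)) ⟩
    1 + length S * 1 ∎
    where open ≡-Reasoning
          open +-*-Solver
  insertions-count U-unique (s ∷ S) (w ∷ W) S⊆U = begin
    insertions (w ∷ W) (s ∷ S) + suc lW * (n + d * m)
      ≡⟨ cong (_+ suc lW * (n + d * m))
              (trans (insertions-∷ w W (s ∷ S))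
                     (cong₂ _+_ (insertionsAt-zero-∷ U-unique (w ∷ W) s S (S⊆U (here refl))) (tailInsertions-∷ w W s S))) ⟩
    ((h + n) + (t + d * i)) + suc lW * (n + d * m)
      ≡⟨ solve 7 (λ h n t d i lW m → ((h :+ n) :+ (t :+ d :* i)) :+ (con 1 :+ lW) :* (n :+ d :* m)
                  := n :+ ((h :+ t) :+ (con 1 :+ lW) :* n) :+ d :* (i :+ lW :* m) :+ d :* m) refl h n t d i lW m ⟩
    n + ((h + t) + suc lW * n) + d * (i + lW * m) + d * m
      ≡⟨ cong₂ (λ a b → n + a + d * b + d * m)
               (trans (cong (_+ suc lW * n) (sym (insertions-∷ w W S))) (insertions-count U-unique S (w ∷ W) (S⊆U ∘ there)))
               (insertions-count U-unique S W (S⊆U ∘ there)) ⟩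
    n + lS * n + d * (lS * m) + d * m
      ≡⟨ solve 4 (λ n lS d m → n :+ lS :* n :+ d :* (lS :* m) :+ d :* m := (con 1 :+ lS) :* (n :+ d :* m)) refl n lS d m ⟩
    suc lS * (n + d * m) ∎
    where
    open ≡-Reasoning
    open +-*-Solver
    lW = length W
    lS = length S
    n = embeddings (w ∷ W) S
    m = embeddings W S
    d = δ w s
    h = insertionsAt 0 (w ∷ W) S
    t = tailInsertions w W S
    i = insertions W S

insertionMass : List Str → Str → Str → ℕ → ℕ
insertionMass 𝒜 S V k = sumMap (λ c → embeddings (insertAt k c V) S) (choices 𝒜 V k)

-- An insertion that embeds into the common subsequence S is itself a common subsequence,
-- hence a move of RandomMCS.
insertions≤breakPointInsertions : ∀ A 𝒜 S → CommonSubseq (A ∷ 𝒜) S → ∀ V →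
  (length S ∸ length V) * embeddings V S ≤ sumMap (insertionMass (A ∷ 𝒜) S V) (BreakPoints (A ∷ 𝒜) V)
insertions≤breakPointInsertions A 𝒜 S S-common V = begin
  (length S ∸ length V) * n               ≡⟨ ℕP.*-distribʳ-∸ n (length S) (length V) ⟩
  length S * n ∸ length V * n             ≡⟨ cong (_∸ length V * n) (insertions-count U U-unique S V S⊆U) ⟨
  (insertions U V S + length V * n) ∸ length V * n ≡⟨ ℕP.m+n∸n≡m (insertions U V S) (length V * n) ⟩
  insertions U V S                        ≤⟨ sumMap-≤-support (upTo (suc (length V))) (BreakPoints (A ∷ 𝒜) V)
                                               (λ k → insertionsAt U k V S) (UniqueP.upTo⁺ _) breakPoint ⟩
  sumMap (λ k → insertionsAt U k V S) (BreakPoints (A ∷ 𝒜) V)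
    ≤⟨ sumMap-mono (BreakPoints (A ∷ 𝒜) V) (λ {k} _ →
         sumMap-≤-support U (choices (A ∷ 𝒜) V k) _ U-unique (λ _ pos → choice k (occurs pos))) ⟩
  sumMap (insertionMass (A ∷ 𝒜) S V) (BreakPoints (A ∷ 𝒜) V) ∎
  where
  open ℕP.≤-Reasoning
  n = embeddings V S
  U = deduplicate ℕ._≟_ S
  U-unique = UniqueD.deduplicate-! ℕ._≟_ S
  S⊆U : ∀ {s} → s ∈ S → s ∈ U
  S⊆U = MP.∈-deduplicate⁺ ℕ._≟_
  occurs : ∀ {W} → 0 < embeddings W S → CommonSubseq (A ∷ 𝒜) W
  occurs pos = All.map (⊆-trans (embeddings-pos⇒⊆ _ S pos)) S-common
  choice : ∀ k {c} → CommonSubseq (A ∷ 𝒜) (insertAt k c V) → c ∈ choices (A ∷ 𝒜) V k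
  choice k = ∈-choices⁺ A 𝒜 V k
  breakPoint : ∀ {k} → k ∈ upTo (suc (length V)) → 0 < insertionsAt U k V S → k ∈ BreakPoints (A ∷ 𝒜) V
  breakPoint {k} k∈ pos with sumMap-pos U (λ c → embeddings (insertAt k c V) S) pos
  ... | c , _ , pos′ = ∈-BreakPoints⁺ (A ∷ 𝒜) V (ℕP.≤-pred (MP.∈-upTo⁻ k∈)) (choice k (occurs pos′))

0≤runProb : ∀ f 𝒜 M V → 0ℚ ℚ.≤ runProb f 𝒜 M V
0≤runProb f       𝒜 M V with BreakPoints 𝒜 V
0≤runProb f       𝒜 M V | [] with does (LP.≡-dec ℕ._≟_ V M)
... | true  = ℚP.≤-trans (ℚP.≤-reflexive (ℚP.0/n≡0 1)) (0≤frac 1 1)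
... | false = ℚP.≤-refl
0≤runProb zero    𝒜 M V | _ ∷ _ = ℚP.≤-refl
0≤runProb (suc f) 𝒜 M V | ks@(_ ∷ _) =
  0≤uniformAvg ks _ (λ {k} _ → 0≤uniformAvg (choices 𝒜 V k) _
                                  (λ {c} _ → 0≤runProb f 𝒜 M (insertAt k c V)))

fuel-insertAt : ∀ {n} f k c (V : Str) → n ≤ suc f + length V → n ≤ f + length (insertAt k c V)
fuel-insertAt {n} f k c V = subst (n ≤_) (trans (sym (ℕP.+-suc f (length V)))
                                                (cong (f +_) (sym (length-insertAt k c V))))

-- From a common subsequence containing S, every run stops at an MCS containing S: at M.
1≤runProb : ∀ A 𝒜 M S → IsDistinguishing (A ∷ 𝒜) M S →
            ∀ f V → CommonSubseq (A ∷ 𝒜) V → S ⊆ V → suc (length A) ≤ f + length V →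
            1ℚ ℚ.≤ runProb f (A ∷ 𝒜) M V
1≤runProb A 𝒜 M S S-dist f V common S⊆V fuel with BreakPoints (A ∷ 𝒜) V in eq
... | [] with proj₂ S-dist V (BreakPoints≡[]⇒IsMCS A 𝒜 V common eq) S⊆V
...   | refl rewrite dec-true (LP.≡-dec ℕ._≟_ V V) refl = ℚP.≤-refl
1≤runProb A 𝒜 M S S-dist zero V common S⊆V fuel | k ∷ _ =
  ⊥-elim (ℕP.<-asym fuel (breakPoint⇒shorter A 𝒜 V (subst (k ∈_) (sym eq) (here refl))))
1≤runProb A 𝒜 M S S-dist (suc f) V common S⊆V fuel | ks@(_ ∷ _) =
  1≤uniformAvg ks _ (here refl) λ {k} k∈ →
    let c∈ = proj₂ (proj₂ (∈-BreakPoints⁻ (A ∷ 𝒜) V (subst (k ∈_) (sym eq) k∈))) in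
    1≤uniformAvg (choices (A ∷ 𝒜) V k) _ c∈ λ {c} c∈ →
      1≤runProb A 𝒜 M S S-dist f (insertAt k c V) (∈-choices⁻ A 𝒜 V k c∈)
                (⊆-trans S⊆V (⊆-insertAt k c V)) (fuel-insertAt f k c V fuel)

module _ (A : Str) (𝒜 : List Str) (C : ℕ) .{{_ : NonZero C}}
         (|commonChar|≤C : length (commonChar (A ∷ 𝒜)) ≤ C)
         (M S : Str) (S-dist : IsDistinguishing (A ∷ 𝒜) M S) (S-common : CommonSubseq (A ∷ 𝒜) S) where

  private
    D : ℕ
    D = length S

  weight : ℕ → ℕ
  weight j = j ! * (D ∸ j) ! * C ^ j

  total : ℕ
  total = D ! * C ^ D

  instance
    total≢0 : NonZero total
    total≢0 = ℕP.m*n≢0 (D !) (C ^ D) {{ℕP._!≢0 D}} {{ℕP.m^n≢0 C D}}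

  -- lowerBound V = embeddings V S / (binomial D |V| · C ^ (D ∸ |V|)).
  lowerBound : Str → ℚ
  lowerBound V = frac (weight (length V) * embeddings V S) total

  weight-step : ∀ j → j < D → weight (suc j) * (D ∸ j) ≡ weight j * C * suc j
  weight-step j j<D rewrite ℕP.+-∸-assoc 1 j<D =
    solve 6 (λ j e J E c P → ((con 1 :+ j) :* J) :* E :* (c :* P) :* (con 1 :+ e)
               := J :* ((con 1 :+ e) :* E) :* P :* c :* (con 1 :+ j))
          refl j (D ∸ suc j) (j !) ((D ∸ suc j) !) C (C ^ j)
    where open +-*-Solver

  lowerBound-unembeddable : ∀ V → embeddings V S ≡ 0 → lowerBound V ℚ.≤ 0ℚ
  lowerBound-unembeddable V eq = ℚP.≤-trans
    (frac-mono (weight (length V) * embeddings V S) total 0 1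
      (ℕP.≤-reflexive (trans (cong (λ n → weight (length V) * n * 1) eq)
                             (cong (_* 1) (ℕP.*-zeroʳ (weight (length V)))))))
    (ℚP.≤-reflexive (ℚP.0/n≡0 1))

  lowerBound-S : lowerBound S ℚ.≤ 1ℚ
  lowerBound-S rewrite embeddings-self S | ℕP.n∸n≡0 D = frac-mono (D ! * 1 * C ^ D * 1) total 1 1 (ℕP.≤-reflexive
    (solve 2 (λ x y → x :* con 1 :* y :* con 1 :* con 1 := con 1 :* (x :* y)) refl (D !) (C ^ D)))
    where open +-*-Solver

  lowerBound-[] : invPow C D ℚ.≤ lowerBound []
  lowerBound-[] = frac-mono 1 (C ^ D) (weight 0 * embeddings [] S) total {{ℕP.m^n≢0 C D}}
    (ℕP.≤-reflexive (solve 2 (λ x y → con 1 :* (x :* y) := con 1 :* x :* con 1 :* con 1 :* y)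
                           refl (D !) (C ^ D)))
    where open +-*-Solver

  lowerBound≤average : ∀ V (P : List ℕ) (r : Str → ℚ) → length P ≤ suc (length V) → length V < D →
    (D ∸ length V) * embeddings V S ≤ sumMap (insertionMass (A ∷ 𝒜) S V) P →
    (∀ k c → lowerBound (insertAt k c V) ℚ.≤ r (insertAt k c V)) →
    lowerBound V ℚ.≤
      uniformAvg (map (λ k → uniformAvg (map (λ c → r (insertAt k c V)) (choices (A ∷ 𝒜) V k))) P)
  lowerBound≤average V P r |P|≤ |V|<D counted IH = ℚP.≤-trans
    (frac-mono (weight j * n) total X (total * C * suc j) {{total≢0}} {{ℕP.m*n≢0 (total * C) (suc j) {{total·C≢0}}}} arith)
    (frac-sum≤uniformAvg P _ choiceMass (total * C) (suc j) {{total·C≢0}} |P|≤ averageChoices)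
    where
    j = length V
    n = embeddings V S
    a′ = weight (suc j)
    total·C≢0 = ℕP.m*n≢0 total C
    choiceMass : ℕ → ℕ
    choiceMass k = sumMap (λ c → a′ * embeddings (insertAt k c V) S) (choices (A ∷ 𝒜) V k)
    X = sumMap choiceMass P
    X≡ : X ≡ a′ * sumMap (insertionMass (A ∷ 𝒜) S V) P
    X≡ = trans (sumMap-cong P (λ {k} _ → sumMap-*ˡ (choices (A ∷ 𝒜) V k) a′ _))
               (sumMap-*ˡ P a′ (insertionMass (A ∷ 𝒜) S V))
    arith : weight j * n * (total * C * suc j) ≤ X * total
    arith = begin
      weight j * n * (total * C * suc j)  ≡⟨ solve 5 (λ x n z c s → x :* n :* (z :* c :* s) := x :* c :* s :* n :* z)
                                                    refl (weight j) n total C (suc j) ⟩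
      weight j * C * suc j * n * total    ≡⟨ cong (λ t → t * n * total) (weight-step j |V|<D) ⟨
      a′ * (D ∸ j) * n * total            ≡⟨ cong (_* total) (ℕP.*-assoc a′ (D ∸ j) n) ⟩
      a′ * ((D ∸ j) * n) * total          ≤⟨ ℕP.*-monoˡ-≤ total (ℕP.*-monoʳ-≤ a′ counted) ⟩
      a′ * sumMap (insertionMass (A ∷ 𝒜) S V) P * total ≡⟨ cong (_* total) X≡ ⟨
      X * total ∎
      where open ℕP.≤-Reasoning
            open +-*-Solver
    averageChoices : ∀ {k} → k ∈ P → frac (choiceMass k) (total * C) {{total·C≢0}} ℚ.≤
                       uniformAvg (map (λ c → r (insertAt k c V)) (choices (A ∷ 𝒜) V k))
    averageChoices {k} _ = frac-sum≤uniformAvg (choices (A ∷ 𝒜) V k) (λ c → r (insertAt k c V))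
      (λ c → a′ * embeddings (insertAt k c V) S) total C
      (ℕP.≤-trans (length-choices A 𝒜 V k) |commonChar|≤C)
      (λ {c} _ → subst (λ m → frac (weight m * embeddings (insertAt k c V) S) total ℚ.≤ r (insertAt k c V))
                       (length-insertAt k c V) (IH k c))

  lowerBound-step : ∀ f V → suc (length A) ≤ suc f + length V → 0 < embeddings V S → length V < D →
    (∀ W → suc (length A) ≤ f + length W → lowerBound W ℚ.≤ runProb f (A ∷ 𝒜) M W) →
    lowerBound V ℚ.≤ runProb (suc f) (A ∷ 𝒜) M V
  lowerBound-step f V fuel pos |V|<D IH
    with BreakPoints (A ∷ 𝒜) V | insertions≤breakPointInsertions A 𝒜 S S-common V
       | length-BreakPoints (A ∷ 𝒜) V
  ... | []        | counted | _   =
    ⊥-elim (ℕP.n≮0 (ℕP.≤-trans (ℕP.*-mono-≤ (ℕP.m<n⇒0<n∸m |V|<D) pos) counted))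
  ... | P@(_ ∷ _) | counted | |P|≤ =
    lowerBound≤average V P (runProb f (A ∷ 𝒜) M) |P|≤ |V|<D counted
                       (λ k c → IH (insertAt k c V) (fuel-insertAt f k c V fuel))

  lowerBound≤runProb : ∀ f V → suc (length A) ≤ f + length V → lowerBound V ℚ.≤ runProb f (A ∷ 𝒜) M V
  lowerBound≤runProb f V fuel with embeddings V S ℕ.≟ 0
  ... | yes eq = ℚP.≤-trans (lowerBound-unembeddable V eq) (0≤runProb f (A ∷ 𝒜) M V)
  ... | no ≢0
    with pos ← ℕP.n≢0⇒n>0 ≢0
    with V⊆S ← embeddings-pos⇒⊆ V S pos
    with ℕP.m≤n⇒m<n∨m≡n (SP.length-mono-≤ V⊆S)
  ...   | inj₂ |V|≡D with refl ← ≋⇒≡ (SP.to-≋ |V|≡D V⊆S) =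
    ℚP.≤-trans lowerBound-S (1≤runProb A 𝒜 M S S-dist f S S-common ⊆-refl fuel)
  ...   | inj₁ |V|<D = step f fuel
    where
    step : ∀ g → suc (length A) ≤ g + length V → lowerBound V ℚ.≤ runProb g (A ∷ 𝒜) M V
    step zero    fuel = ⊥-elim (ℕP.<-asym fuel (ℕP.<-≤-trans |V|<D (SP.length-mono-≤ (All.head S-common))))
    step (suc g) fuel = lowerBound-step g V fuel pos |V|<D (lowerBound≤runProb g)

theorem4p2 : (A₁ : Str) (𝒜′ : List Str) (C D : ℕ) .{{_ : NonZero C}}
    → length (commonChar (A₁ ∷ 𝒜′)) ≤ C
    → (M : Str) → IsMCS (A₁ ∷ 𝒜′) M
    → Σ Str (λ S → IsDistinguishing (A₁ ∷ 𝒜′) M S × length S ≤ D)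
    → invPow C D ≤ℚ ProbMCS (A₁ ∷ 𝒜′) M
theorem4p2 A₁ 𝒜′ C D |commonChar|≤C M (M-common , _) (S , S-dist , |S|≤D) = begin
  invPow C D                                  ≤⟨ invPow-antitone C |S|≤D ⟩
  invPow C (length S)                         ≤⟨ lowerBound-[] A₁ 𝒜′ C |commonChar|≤C M S S-dist S-common ⟩
  lowerBound A₁ 𝒜′ C |commonChar|≤C M S S-dist S-common []
    ≤⟨ lowerBound≤runProb A₁ 𝒜′ C |commonChar|≤C M S S-dist S-common (budget (A₁ ∷ 𝒜′)) []
                          (ℕP.≤-reflexive (sym (ℕP.+-identityʳ _))) ⟩
  ProbMCS (A₁ ∷ 𝒜′) M ∎
  where
  open ℚP.≤-Reasoning
  S-common = All.map (⊆-trans (proj₁ S-dist)) M-common
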